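{- Let $(a,b)$ be a cherry in a complete binary $\mathcal{L}$-network $N$. Then $N^{(a,b)}$ is a complete binary $\mathcal{L}$-network.
   Context: Networks. A semidirected graph $N=(V,E)$ has a finite node set and a finite multiset of edges $E=E_U\sqcup E_D$ (parallel edges allowed); edges in $E_U$ are undirected, each edge in $E_D$ is directed from parent to child, written $u\to v$. $\deg_i(v)$, $\deg_o(v)$, $\deg_u(v)$ count directed edges into $v$, out of $v$, and undirected edges at $v$; $\deg(v)$ is their sum. $v$ is a root if $\deg_i(v)=\deg_u(v)=0$, a leaf if $\deg_o(v)=\deg_u(v)=0$, a tree node if $\deg_i(v)\le1$, hybrid if $\deg_i(v)>1$. A cycle is semidirected if its undirected edges can be oriented to make it directed; an SDAG has no semidirected cycle. $N$ is binary if roots have degree 0, 2 or 3, leaves degree 0 or 1, other nodes degree 3. For $\mathcal{L}=[n]$, an $\mathcal{L}$-network is an SDAG whose leaves are tree nodes, with an injective labelling of leaves by $\mathcal{L}$. $u\sim v$ if joined by a path of undirected edges; $N/{\sim}$ contracts all undirected edges. $N$ is complete if edges at leaves are directed towards leaves and no $\sim$-class with more than one node has an incoming directed edge in $N/{\sim}$. A root component is the subgraph induced by a $\sim$-class that is a root of $N/{\sim}$. Cherries. For non-isolated leaves $a\neq b$ with parents $p_a,p_b$: $(a,b)$ is a tree cherry if $p_a=p_b$, a reticulate cherry if $p_a$ is hybrid and $p_b$ is a parent of $p_a$. A non-leaf node $v$ is suppressible if $\deg(v)=2$ and $\{v\}$ is not a root component, or $\deg(v)=1$, $\{v\}$ is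 a root component and its child is a tree node; suppressing deletes $v$ and its edges and, if $\deg(v)=2$ with neighbours $u,w$, adds an edge $uw$, directed $u\to w$ if $v$ was incident to a directed edge $v\to w$, undirected otherwise. $N^{(a,b)}$: for a tree cherry delete $a$ and its edge, then suppress $p_a$ if suppressible; for a reticulate cherry delete $p_b\to p_a$, suppress $p_b$ if suppressible, then suppress $p_a$. -}

module Defs where

open import Data.Nat using (ℕ; zero; suc; _+_; _≤_; _<_; _≡ᵇ_)
open import Data.Bool using (Bool; true; false; if_then_else_; _∨_; not)
open import Data.List using (List; []; _∷_; _++_; length; lookup; filterᵇ)
open import Data.List.Membership.Propositional using (_∈_)
open import Data.List.Relation.Unary.Unique.Propositional using (Unique)
open import Data.List.Relation.Unary.Any using (_─_)
open import Data.Fin using (Fin; inject₁; fromℕ) renaming (zero to fzero; suc to fsuc)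
open import Data.Maybe using (Maybe; Is-just)
open import Data.Product using (Σ; _×_; _,_)
open import Data.Sum using (_⊎_)
open import Function using (_∘_)
open import Function.Definitions using (Injective)
open import Relation.Binary.PropositionalEquality using (_≡_)
open import Relation.Nullary using (¬_)

-- Semidirected (multi)graphs with an (arbitrary) leaf labelling by L = Fin n.
-- Nodes are natural-number names; the node set is a duplicate-free list;
-- the edge multiset is a list (parallel edges = repeated entries).

data Edge : Set where
  und : ℕ → ℕ → Edge
  dir : ℕ → ℕ → Edge   -- directed edge u → v (parent u, child v)

end₁ end₂ : Edge → ℕ
end₁ (und x _) = x
end₁ (dir x _) = x
end₂ (und _ y) = y
end₂ (dir _ y) = y

record Net (n : ℕ) : Set where
  constructor net
  field
    nodes : List ℕ
    edges : List Edge
    lab   : ℕ → Maybe (Fin n)   -- only its values on leaves matter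
open Net public

module _ {n : ℕ} where

  WellFormed : Net n → Set
  WellFormed N = Unique (nodes N)
    × (∀ e → e ∈ edges N → end₁ e ∈ nodes N × end₂ e ∈ nodes N)

-- Degrees (an undirected loop counts twice)

b2n : Bool → ℕ
b2n true  = 1
b2n false = 0

count : (Edge → ℕ) → List Edge → ℕ
count f []       = 0
count f (e ∷ es) = f e + count f es

inC outC undC : ℕ → Edge → ℕ
inC v (dir _ y) = b2n (y ≡ᵇ v)
inC v (und _ _) = 0
outC v (dir x _) = b2n (x ≡ᵇ v)
outC v (und _ _) = 0
undC v (und x y) = b2n (x ≡ᵇ v) + b2n (y ≡ᵇ v)
undC v (dir _ _) = 0

module _ {n : ℕ} where

  degIn degOut degU deg : Net n → ℕ → ℕ
  degIn  N v = count (inC v) (edges N)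
  degOut N v = count (outC v) (edges N)
  degU   N v = count (undC v) (edges N)
  deg    N v = degIn N v + degOut N v + degU N v

  IsRoot IsLeaf IsTreeNode IsHybrid : Net n → ℕ → Set
  IsRoot N v     = degIn N v ≡ 0 × degU N v ≡ 0
  IsLeaf N v     = degOut N v ≡ 0 × degU N v ≡ 0
  IsTreeNode N v = degIn N v ≤ 1
  IsHybrid N v   = 1 < degIn N v

data Trav : Edge → ℕ → ℕ → Set where
  tdir  : ∀ {u v} → Trav (dir u v) u v
  tund₁ : ∀ {u v} → Trav (und u v) u v
  tund₂ : ∀ {u v} → Trav (und u v) v u

-- a cycle v₀ e₁ v₁ … e_k v_k = v₀ (k ≥ 1) with distinct vertices v₀ … v_{k-1}
-- and distinct edges (as elements of the multiset, i.e. positions), whose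
-- undirected edges can be oriented to make it directed.
SemidirectedCycle : ∀ {n} → Net n → Set
SemidirectedCycle N =
  Σ ℕ λ m →
  Σ (Fin (suc (suc m)) → ℕ) λ vs →
  Σ (Fin (suc m) → Fin (length (edges N))) λ es →
    vs (fromℕ (suc m)) ≡ vs fzero
    × Injective _≡_ _≡_ (vs ∘ inject₁)
    × Injective _≡_ _≡_ es
    × (∀ i → Trav (lookup (edges N) (es i)) (vs (inject₁ i)) (vs (fsuc i)))

IsSDAG : ∀ {n} → Net n → Set
IsSDAG N = ¬ SemidirectedCycle N

module _ {n : ℕ} where

  IsLNetwork : Net n → Set
  IsLNetwork N = WellFormed N × IsSDAG N
    × (∀ v → v ∈ nodes N → IsLeaf N v → IsTreeNode N v)
    × (∀ v → v ∈ nodes N → IsLeaf N v → Is-just (lab N v))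
    × (∀ u v → u ∈ nodes N → v ∈ nodes N → IsLeaf N u → IsLeaf N v
         → lab N u ≡ lab N v → u ≡ v)

  IsBinary : Net n → Set
  IsBinary N = ∀ v → v ∈ nodes N →
      (IsRoot N v → deg N v ≡ 0 ⊎ deg N v ≡ 2 ⊎ deg N v ≡ 3)
    × (IsLeaf N v → deg N v ≡ 0 ⊎ deg N v ≡ 1)
    × (¬ IsRoot N v → ¬ IsLeaf N v → deg N v ≡ 3)

-- u ~ v : joined by a path of undirected edges
data UPath (E : List Edge) : ℕ → ℕ → Set where
  here : ∀ {v} → UPath E v v
  step : ∀ {u w v} → (und u w ∈ E ⊎ und w u ∈ E) → UPath E w v → UPath E u v

incident : ℕ → Edge → Bool
incident v e = (end₁ e ≡ᵇ v) ∨ (end₂ e ≡ᵇ v)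

module _ {n : ℕ} where

  -- (i) every edge at a leaf is directed towards the leaf;
  -- (ii) no ~-class with more than one node has an incoming directed edge
  --      in N/~ : the head of every directed edge has a singleton ~-class.
  IsComplete : Net n → Set
  IsComplete N =
      (∀ ℓ → ℓ ∈ nodes N → IsLeaf N ℓ → ∀ e → e ∈ edges N → incident ℓ e ≡ true
         → Σ ℕ λ x → e ≡ dir x ℓ)
    × (∀ x y → dir x y ∈ edges N → ∀ z → UPath (edges N) y z → z ≡ y)

  IsCompleteBinaryLNetwork : Net n → Set
  IsCompleteBinaryLNetwork N = IsLNetwork N × IsBinary N × IsComplete N

  IsCherry : Net n → ℕ → ℕ → Set
  IsCherry N a b =
    a ∈ nodes N × b ∈ nodes N × ¬ (a ≡ b)
    × IsLeaf N a × IsLeaf N b × ¬ (deg N a ≡ 0) × ¬ (deg N b ≡ 0)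
    × Σ ℕ λ pa → Σ ℕ λ pb → dir pa a ∈ edges N × dir pb b ∈ edges N
      × (pa ≡ pb ⊎ (IsHybrid N pa × dir pb pa ∈ edges N))

  -- {v} is a root component: the ~-class of v is {v} and it is a root of N/~
  -- (no incoming directed edge; N/~ has no undirected edges).
  SingletonRootComponent : Net n → ℕ → Set
  SingletonRootComponent N v =
    (∀ z → UPath (edges N) v z → z ≡ v) × (∀ x → ¬ (dir x v ∈ edges N))

  Suppressible : Net n → ℕ → Set
  Suppressible N v = v ∈ nodes N × ¬ IsLeaf N v
    × ((deg N v ≡ 2 × ¬ SingletonRootComponent N v)
       ⊎ (deg N v ≡ 1 × SingletonRootComponent N v
          × (∀ c → dir v c ∈ edges N → IsTreeNode N c)))

other : ℕ → Edge → ℕ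
other v e = if end₁ e ≡ᵇ v then end₂ e else end₁ e

isOutOf : ℕ → Edge → Bool
isOutOf v (dir x _) = x ≡ᵇ v
isOutOf v (und _ _) = false

-- the new edge uw added when suppressing a degree-2 node v
bridge : ℕ → List Edge → List Edge
bridge v (e₁ ∷ e₂ ∷ []) =
  if isOutOf v e₂ then dir (other v e₁) (other v e₂) ∷ []
  else if isOutOf v e₁ then dir (other v e₂) (other v e₁) ∷ []
  else und (other v e₁) (other v e₂) ∷ []
bridge v _ = []

module _ {n : ℕ} where

  deleteNode : ℕ → Net n → Net n
  deleteNode v N = record N
    { nodes = filterᵇ (λ x → not (x ≡ᵇ v)) (nodes N)
    ; edges = filterᵇ (not ∘ incident v) (edges N) }

  suppress : ℕ → Net n → Net n
  suppress v N = record (deleteNode v N)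
    { edges = bridge v (filterᵇ (incident v) (edges N))
              ++ filterᵇ (not ∘ incident v) (edges N) }

  data SuppressIfSuppressible (v : ℕ) (N : Net n) : Net n → Set where
    supp   : Suppressible N v → SuppressIfSuppressible v N (suppress v N)
    nosupp : ¬ Suppressible N v → SuppressIfSuppressible v N N

  removeEdge : (N : Net n) {e : Edge} → e ∈ edges N → Net n
  removeEdge N p = record N { edges = edges N ─ p }

  -- Reduced N a b M : M is N^{(a,b)}
  data Reduced (N : Net n) (a b : ℕ) : Net n → Set where
    treeCherry : ∀ {p M} → dir p a ∈ edges N → dir p b ∈ edges N
      → SuppressIfSuppressible p (deleteNode a N) M
      → Reduced N a b M
    reticulateCherry : ∀ {pa pb M} → dir pa a ∈ edges N → dir pb b ∈ edges N
      → IsHybrid N pa → (e : dir pb pa ∈ edges N)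
      → SuppressIfSuppressible pb (removeEdge N e) M
      → Reduced N a b (suppress pa M)

-- Every step of N ↦ N^(a,b) deletes nodes or edges, except that suppressing a node v with edges
-- u — v → w adds an edge u → w.  Here w is always a leaf of N (a or b) that had a parent in N, so
-- every new edge points into a leaf.  A semidirected cycle has to leave each vertex it enters,
-- hence uses no such edge and is already a cycle of N; likewise undirected paths are paths of N and
-- the head of every directed edge had a parent in N, which gives completeness.  Binarity is checked
-- node by node on in-, out- and undirected degrees: they are unchanged, except that the neighbour u
-- of a suppressed node may trade an undirected edge for an outgoing one, the parent of b may survive
-- as a root with two children, and b may lose its only edge.

module Submission where

open import Defs
import Algebra.Properties.CommutativeSemigroup as CommutativeSemigroupProperties
open import Data.Bool using (Bool; true; false; not; T)
open import Data.Bool.Properties using (T?)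
open import Data.Empty using (⊥-elim)
open import Data.Fin using (Fin; inject₁; fromℕ) renaming (zero to fzero; suc to fsuc)
import Data.Fin.Properties as Fin
open import Data.List using (List; []; _∷_; _++_; length; lookup; filterᵇ)
open import Data.List.Membership.Propositional using (_∈_)
open import Data.List.Membership.Propositional.Properties
  using (∈-filter⁻; ∈-filter⁺; ∈-++⁻; ∈-++⁺ʳ; ∈-lookup)
open import Data.List.Relation.Unary.Any using (here; there; _─_; index)
open import Data.List.Relation.Unary.Any.Properties using (lookup-index)
import Data.List.Relation.Unary.Unique.Propositional.Properties as Unique
open import Data.Maybe using (Is-just)
open import Data.Nat using (ℕ; zero; suc; _+_; _≤_; _<_; _≡ᵇ_; _≟_; z≤n; s≤s)
open import Data.Nat.Properties
  using ( +-assoc; +-comm; +-identityʳ; +-suc; +-cancelʳ-≡; +-commutativeSemigroup; suc-injective; 1+n≢0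
        ; m+n≡0⇒m≡0; m+n≡0⇒n≡0; ≤-refl; ≤-trans; m≤m+n; m≤n+m; n≤0⇒n≡0; <⇒≢ )
open import Data.Product using (Σ; _×_; _,_; proj₁; proj₂; map₂)
open import Data.Sum as Sum using (_⊎_; inj₁; inj₂)
open import Data.Unit using (tt)
open import Function using (_∘_)
open import Relation.Binary.PropositionalEquality
open import Relation.Nullary using (¬_; Reflects; ofʸ; ofⁿ; proof; contradiction; yes; no)
open import Relation.Nullary.Reflects using (det; ¬-reflects; _⊎-reflects_)

open CommutativeSemigroupProperties +-commutativeSemigroup using (interchange; x∙yz≈y∙xz; xy∙z≈zy∙x)

≡ᵇ-reflects-≡ : ∀ m n → Reflects (m ≡ n) (m ≡ᵇ n)
≡ᵇ-reflects-≡ m n = proof (m ≟ n)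

≡ᵇ-refl : ∀ m → (m ≡ᵇ m) ≡ true
≡ᵇ-refl m = det (≡ᵇ-reflects-≡ m m) (ofʸ refl)

≢⇒≡ᵇ≡false : ∀ {m n} → m ≢ n → (m ≡ᵇ n) ≡ false
≢⇒≡ᵇ≡false {m} {n} m≢n = det (≡ᵇ-reflects-≡ m n) (ofⁿ m≢n)

b2n-refl : ∀ m → b2n (m ≡ᵇ m) ≡ 1
b2n-refl = cong b2n ∘ ≡ᵇ-refl

b2n-≢ : ∀ {m n} → m ≢ n → b2n (m ≡ᵇ n) ≡ 0
b2n-≢ = cong b2n ∘ ≢⇒≡ᵇ≡false

reflects-fromWitness : ∀ {A : Set} {b} → Reflects A b → A → T b
reflects-fromWitness (ofʸ _) _ = tt
reflects-fromWitness (ofⁿ ¬a) a = ¬a a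

reflects-toWitness : ∀ {A : Set} {b} → Reflects A b → T b → A
reflects-toWitness (ofʸ a) _ = a

module _ {A : Set} {P : A → Set} {p : A → Bool} (p-reflects : ∀ x → Reflects (P x) (p x)) where

  ∈-filterᵇ⁻ : ∀ {x xs} → x ∈ filterᵇ p xs → x ∈ xs × P x
  ∈-filterᵇ⁻ {x} = map₂ (reflects-toWitness (p-reflects x)) ∘ ∈-filter⁻ (T? ∘ p)

  ∈-filterᵇ⁺ : ∀ {x xs} → x ∈ xs → P x → x ∈ filterᵇ p xs
  ∈-filterᵇ⁺ {x} x∈ px = ∈-filter⁺ (T? ∘ p) x∈ (reflects-fromWitness (p-reflects x) px)

≢-reflects : ∀ v x → Reflects (x ≢ v) (not (x ≡ᵇ v))
≢-reflects v x = ¬-reflects (≡ᵇ-reflects-≡ x v)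

∈-─⁻ : ∀ {A : Set} {d x : A} L (d∈L : d ∈ L) → x ∈ (L ─ d∈L) → x ∈ L
∈-─⁻ (y ∷ L) (here refl)  x∈        = there x∈
∈-─⁻ (y ∷ L) (there d∈L) (here refl) = here refl
∈-─⁻ (y ∷ L) (there d∈L) (there x∈)  = there (∈-─⁻ L d∈L x∈)

∈-─⁺ : ∀ {A : Set} {d x : A} L (d∈L : d ∈ L) → x ∈ L → x ≢ d → x ∈ (L ─ d∈L)
∈-─⁺ (y ∷ L) (here refl)  (here refl) x≢d = contradiction refl x≢d
∈-─⁺ (y ∷ L) (here refl)  (there x∈)  _   = x∈
∈-─⁺ (y ∷ L) (there d∈L) (here refl) _   = here refl
∈-─⁺ (y ∷ L) (there d∈L) (there x∈)  x≢d = there (∈-─⁺ L d∈L x∈ x≢d)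

IsPair : ∀ {A : Set} → List A → A → A → Set
IsPair L e d = L ≡ e ∷ d ∷ [] ⊎ L ≡ d ∷ e ∷ []

pair-∈ : ∀ {A : Set} {L : List A} {e d} → IsPair L e d → e ∈ L
pair-∈ (inj₁ refl) = here refl
pair-∈ (inj₂ refl) = there (here refl)

pair-∈ʳ : ∀ {A : Set} {L : List A} {e d} → IsPair L e d → d ∈ L
pair-∈ʳ (inj₁ refl) = there (here refl)
pair-∈ʳ (inj₂ refl) = here refl

∈-pair : ∀ {A : Set} {L : List A} {e d x} → IsPair L e d → x ∈ L → x ≡ e ⊎ x ≡ d
∈-pair (inj₁ refl) (here refl)         = inj₁ refl
∈-pair (inj₁ refl) (there (here refl)) = inj₂ refl
∈-pair (inj₂ refl) (here refl)         = inj₂ refl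
∈-pair (inj₂ refl) (there (here refl)) = inj₁ refl

─≡singleton⇒pair : ∀ {A : Set} {d e : A} L (d∈L : d ∈ L) → (L ─ d∈L) ≡ e ∷ [] → IsPair L e d
─≡singleton⇒pair (x ∷ L)     (here refl)         refl = inj₂ refl
─≡singleton⇒pair (x ∷ y ∷ L) (there (here refl)) refl = inj₁ refl
─≡singleton⇒pair (x ∷ y ∷ L) (there (there d∈L)) ()

data Embedding {A : Set} (D : A → Set) : List A → List A → Set where
  []   : Embedding D [] []
  keep : ∀ {e xs ys} → Embedding D xs ys → Embedding D (e ∷ xs) (e ∷ ys)
  skip : ∀ {e xs ys} → Embedding D xs ys → Embedding D xs (e ∷ ys)
  new  : ∀ {e xs ys} → D e → Embedding D xs ys → Embedding D (e ∷ xs) ys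

module _ {A : Set} {D : A → Set} where

  embedding-refl : ∀ xs → Embedding D xs xs
  embedding-refl []       = []
  embedding-refl (x ∷ xs) = keep (embedding-refl xs)

  embedding-trans : ∀ {xs ys zs} → Embedding D xs ys → Embedding D ys zs → Embedding D xs zs
  embedding-trans (new d p) q        = new d (embedding-trans p q)
  embedding-trans []        []       = []
  embedding-trans p         (skip q) = skip (embedding-trans p q)
  embedding-trans (keep p)  (keep q) = keep (embedding-trans p q)
  embedding-trans (skip p)  (keep q) = skip (embedding-trans p q)
  embedding-trans (keep p)  (new d q) = new d (embedding-trans p q)
  embedding-trans (skip p)  (new d q) = embedding-trans p q

  embedding-filterᵇ : ∀ (p : A → Bool) xs → Embedding D (filterᵇ p xs) xs
  embedding-filterᵇ p []       = []
  embedding-filterᵇ p (x ∷ xs) with p x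
  ... | true  = keep (embedding-filterᵇ p xs)
  ... | false = skip (embedding-filterᵇ p xs)

  embedding-─ : ∀ {e} xs (e∈xs : e ∈ xs) → Embedding D (xs ─ e∈xs) xs
  embedding-─ (x ∷ xs) (here refl)  = skip (embedding-refl xs)
  embedding-─ (x ∷ xs) (there e∈xs) = keep (embedding-─ xs e∈xs)

  embedding-++ : ∀ new-edges {xs ys} → (∀ {e} → e ∈ new-edges → D e) → Embedding D xs ys
    → Embedding D (new-edges ++ xs) ys
  embedding-++ []      _ emb = emb
  embedding-++ (e ∷ B) d emb = new (d (here refl)) (embedding-++ B (d ∘ there) emb)

  embedding-∈ : ∀ {xs ys e} → Embedding D xs ys → e ∈ xs → D e ⊎ e ∈ ys
  embedding-∈ (keep emb)  (here refl) = inj₂ (here refl)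
  embedding-∈ (keep emb)  (there e∈)  = Sum.map₂ there (embedding-∈ emb e∈)
  embedding-∈ (skip emb)  e∈          = Sum.map₂ there (embedding-∈ emb e∈)
  embedding-∈ (new d emb) (here refl) = inj₁ d
  embedding-∈ (new d emb) (there e∈)  = embedding-∈ emb e∈

module _ {A : Set} {D : A → Set} where

  embed-index : ∀ {xs ys} → Embedding D xs ys → (i : Fin (length xs)) → ¬ D (lookup xs i) → Fin (length ys)
  embed-index (keep emb)  fzero    ¬d = fzero
  embed-index (keep emb)  (fsuc i) ¬d = fsuc (embed-index emb i ¬d)
  embed-index (skip emb)  i        ¬d = fsuc (embed-index emb i ¬d)
  embed-index (new d emb) fzero    ¬d = contradiction d ¬d
  embed-index (new d emb) (fsuc i) ¬d = embed-index emb i ¬d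

  lookup-embed-index : ∀ {xs ys} (emb : Embedding D xs ys) i ¬d → lookup ys (embed-index emb i ¬d) ≡ lookup xs i
  lookup-embed-index (keep emb)  fzero    ¬d = refl
  lookup-embed-index (keep emb)  (fsuc i) ¬d = lookup-embed-index emb i ¬d
  lookup-embed-index (skip emb)  i        ¬d = lookup-embed-index emb i ¬d
  lookup-embed-index (new d emb) fzero    ¬d = contradiction d ¬d
  lookup-embed-index (new d emb) (fsuc i) ¬d = lookup-embed-index emb i ¬d

  embed-index-injective : ∀ {xs ys} (emb : Embedding D xs ys) i j ¬dᵢ ¬dⱼ
    → embed-index emb i ¬dᵢ ≡ embed-index emb j ¬dⱼ → i ≡ j
  embed-index-injective (keep emb)  fzero    fzero    _   _   _  = refl
  embed-index-injective (keep emb)  (fsuc i) (fsuc j) ¬dᵢ ¬dⱼ eq =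
    cong fsuc (embed-index-injective emb i j ¬dᵢ ¬dⱼ (Fin.suc-injective eq))
  embed-index-injective (skip emb)  i        j        ¬dᵢ ¬dⱼ eq =
    embed-index-injective emb i j ¬dᵢ ¬dⱼ (Fin.suc-injective eq)
  embed-index-injective (new d emb) fzero    _        ¬dᵢ _   _  = contradiction d ¬dᵢ
  embed-index-injective (new d emb) (fsuc i) fzero    _   ¬dⱼ _  = contradiction d ¬dⱼ
  embed-index-injective (new d emb) (fsuc i) (fsuc j) ¬dᵢ ¬dⱼ eq =
    cong fsuc (embed-index-injective emb i j ¬dᵢ ¬dⱼ eq)

count-+ : ∀ f g L → count f L + count g L ≡ count (λ e → f e + g e) L
count-+ f g []      = refl
count-+ f g (e ∷ L) = trans (interchange (f e) (count f L) (g e) (count g L))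
                            (cong (f e + g e +_) (count-+ f g L))

count-filterᵇ : ∀ f (p : Edge → Bool) L →
  count f L ≡ count f (filterᵇ p L) + count f (filterᵇ (not ∘ p) L)
count-filterᵇ f p []      = refl
count-filterᵇ f p (e ∷ L) with p e
... | true  = trans (cong (f e +_) (count-filterᵇ f p L))
                    (sym (+-assoc (f e) (count f (filterᵇ p L)) (count f (filterᵇ (not ∘ p) L))))
... | false = trans (cong (f e +_) (count-filterᵇ f p L))
                    (x∙yz≈y∙xz (f e) (count f (filterᵇ p L)) (count f (filterᵇ (not ∘ p) L)))

count-─ : ∀ f {e} L (e∈L : e ∈ L) → count f L ≡ f e + count f (L ─ e∈L)
count-─ f (x ∷ L) (here refl) = refl
count-─ f (x ∷ L) (there e∈L) =
  trans (cong (f x +_) (count-─ f L e∈L)) (x∙yz≈y∙xz (f x) (f _) (count f (L ─ e∈L)))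

∈⇒≤count : ∀ f {e L} → e ∈ L → f e ≤ count f L
∈⇒≤count f {L = x ∷ L} (here refl) = m≤m+n (f x) (count f L)
∈⇒≤count f {L = x ∷ L} (there e∈L) = ≤-trans (∈⇒≤count f e∈L) (m≤n+m (count f L) (f x))

count≡0⇒≡0 : ∀ f {e L} → count f L ≡ 0 → e ∈ L → f e ≡ 0
count≡0⇒≡0 f c≡0 e∈L = n≤0⇒n≡0 (subst (_ ≤_) c≡0 (∈⇒≤count f e∈L))

≡0⇒count≡0 : ∀ f L → (∀ e → e ∈ L → f e ≡ 0) → count f L ≡ 0
≡0⇒count≡0 f []      _ = refl
≡0⇒count≡0 f (e ∷ L) h = cong₂ _+_ (h e (here refl)) (≡0⇒count≡0 f L (λ e′ → h e′ ∘ there))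

count-pair : ∀ f {L e d} → IsPair L e d → count f L ≡ f e + f d
count-pair f {e = e} {d} (inj₁ refl) = cong (f e +_) (+-identityʳ (f d))
count-pair f {e = e} {d} (inj₂ refl) = trans (cong (f d +_) (+-identityʳ (f e))) (+-comm (f d) (f e))

Positive : (Edge → ℕ) → List Edge → Set
Positive w L = ∀ {e} → e ∈ L → 1 ≤ w e

1≤m⇒m+n≡1⇒n≡0 : ∀ {m n} → 1 ≤ m → m + n ≡ 1 → n ≡ 0
1≤m⇒m+n≡1⇒n≡0 {suc m} _ eq = m+n≡0⇒n≡0 m (suc-injective eq)

count≡0⇒≡[] : ∀ w L → Positive w L → count w L ≡ 0 → L ≡ []
count≡0⇒≡[] w []      _   _   = refl
count≡0⇒≡[] w (e ∷ L) pos c≡0 = contradiction (sym (m+n≡0⇒m≡0 (w e) c≡0)) (<⇒≢ (pos (here refl)))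

count≡1⇒singleton : ∀ w L → Positive w L → count w L ≡ 1 → Σ Edge λ e → L ≡ e ∷ [] × w e ≡ 1
count≡1⇒singleton w (e ∷ L) pos c≡1
  with count≡0⇒≡[] w L (pos ∘ there) (1≤m⇒m+n≡1⇒n≡0 (pos (here refl)) c≡1)
... | refl = e , refl , trans (sym (+-identityʳ (w e))) c≡1

count≡1-∈⇒singleton : ∀ w {d} L → Positive w L → count w L ≡ 1 → d ∈ L → L ≡ d ∷ []
count≡1-∈⇒singleton w L pos c≡1 d∈L with count≡1⇒singleton w L pos c≡1
count≡1-∈⇒singleton w L pos c≡1 (here refl) | _ , refl , _ = refl

count≡2⇒pair : ∀ w {d} L → Positive w L → count w L ≡ 2 → d ∈ L → w d ≡ 1
  → Σ Edge λ e → w e ≡ 1 × IsPair L e d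
count≡2⇒pair w L pos c≡2 d∈L wd≡1
  with count≡1⇒singleton w (L ─ d∈L) (pos ∘ ∈-─⁻ L d∈L) rest≡1
  where
  rest≡1 : count w (L ─ d∈L) ≡ 1
  rest≡1 = suc-injective (trans (cong (_+ count w (L ─ d∈L)) (sym wd≡1)) (trans (sym (count-─ w L d∈L)) c≡2))
... | e , rest≡[e] , we≡1 = e , we≡1 , ─≡singleton⇒pair L d∈L rest≡[e]

Degrees : Set
Degrees = ℕ × ℕ × ℕ

-- deg N v, IsLeaf N v and the condition of IsBinary N at v unfold to total, LeafDegrees and
-- BinaryDegrees of degrees (edges N) v.
degrees : List Edge → ℕ → Degrees
degrees E v = count (inC v) E , count (outC v) E , count (undC v) E

total : Degrees → ℕ
total (i , o , u) = i + o + u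

BinaryDegrees : Degrees → Set
BinaryDegrees (i , o , u) =
    (i ≡ 0 × u ≡ 0 → i + o + u ≡ 0 ⊎ i + o + u ≡ 2 ⊎ i + o + u ≡ 3)
  × (o ≡ 0 × u ≡ 0 → i + o + u ≡ 0 ⊎ i + o + u ≡ 1)
  × (¬ (i ≡ 0 × u ≡ 0) → ¬ (o ≡ 0 × u ≡ 0) → i + o + u ≡ 3)

LeafDegrees : Degrees → Set
LeafDegrees (_ , o , u) = o ≡ 0 × u ≡ 0

binary-nonleaf : ∀ {t} → BinaryDegrees t → ¬ LeafDegrees t → total t ≡ 0 ⊎ total t ≡ 2 ⊎ total t ≡ 3
binary-nonleaf {i , o , u} (root , _ , inner) ¬leaf with i ≟ 0 | u ≟ 0
... | yes i≡0 | yes u≡0 = root (i≡0 , u≡0)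
... | no  i≢0 | _       = inj₂ (inj₂ (inner (i≢0 ∘ proj₁) ¬leaf))
... | yes _   | no  u≢0 = inj₂ (inj₂ (inner (u≢0 ∘ proj₂) ¬leaf))

hybrid-degrees : ∀ {i o u} → BinaryDegrees (i , o , u) → 1 < i → 1 ≤ o → (i , o , u) ≡ (2 , 1 , 0)
hybrid-degrees {suc (suc i)} {suc o} {u} (_ , _ , inner) (s≤s (s≤s _)) (s≤s _) =
  deg≡3⇒ i o u (inner (λ ()) (λ ()))
  where
  deg≡3⇒ : ∀ i o u → suc (suc i) + suc o + u ≡ 3 → (suc (suc i) , suc o , u) ≡ (2 , 1 , 0)
  deg≡3⇒ zero    zero    zero    refl = refl
  deg≡3⇒ zero    zero    (suc u) ()
  deg≡3⇒ zero    (suc o) u       ()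
  deg≡3⇒ (suc i) o       u       eq   = contradiction
    (m+n≡0⇒n≡0 i (m+n≡0⇒m≡0 _ (suc-injective (suc-injective (suc-injective eq))))) λ ()

weight : ℕ → Edge → ℕ
weight v e = inC v e + outC v e + undC v e

deg≡count-weight : ∀ {n} (N : Net n) v → deg N v ≡ count (weight v) (edges N)
deg≡count-weight N v = trans (cong (_+ count (undC v) (edges N)) (count-+ (inC v) (outC v) (edges N)))
                             (count-+ (λ e → inC v e + outC v e) (undC v) (edges N))

Endpoint : ℕ → Edge → Set
Endpoint v e = end₁ e ≡ v ⊎ end₂ e ≡ v

incident-reflects : ∀ v e → Reflects (Endpoint v e) (incident v e)
incident-reflects v e = ≡ᵇ-reflects-≡ (end₁ e) v ⊎-reflects ≡ᵇ-reflects-≡ (end₂ e) v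

¬incident-reflects : ∀ v e → Reflects (¬ Endpoint v e) (not (incident v e))
¬incident-reflects v e = ¬-reflects (incident-reflects v e)

¬endpoint-dir : ∀ {x s t} → x ≢ s → x ≢ t → ¬ Endpoint x (dir s t)
¬endpoint-dir x≢s _ (inj₁ s≡x) = x≢s (sym s≡x)
¬endpoint-dir _ x≢t (inj₂ t≡x) = x≢t (sym t≡x)

¬endpoint⇒inC≡0 : ∀ {v} e → ¬ Endpoint v e → inC v e ≡ 0
¬endpoint⇒inC≡0 (dir x y) ¬ep = b2n-≢ (¬ep ∘ inj₂)
¬endpoint⇒inC≡0 (und x y) ¬ep = refl

¬endpoint⇒outC≡0 : ∀ {v} e → ¬ Endpoint v e → outC v e ≡ 0
¬endpoint⇒outC≡0 (dir x y) ¬ep = b2n-≢ (¬ep ∘ inj₁)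
¬endpoint⇒outC≡0 (und x y) ¬ep = refl

¬endpoint⇒undC≡0 : ∀ {v} e → ¬ Endpoint v e → undC v e ≡ 0
¬endpoint⇒undC≡0 (dir x y) ¬ep = refl
¬endpoint⇒undC≡0 (und x y) ¬ep = cong₂ _+_ (b2n-≢ (¬ep ∘ inj₁)) (b2n-≢ (¬ep ∘ inj₂))

¬endpoint⇒weight≡0 : ∀ {v} e → ¬ Endpoint v e → weight v e ≡ 0
¬endpoint⇒weight≡0 e ¬ep =
  cong₂ _+_ (cong₂ _+_ (¬endpoint⇒inC≡0 e ¬ep) (¬endpoint⇒outC≡0 e ¬ep)) (¬endpoint⇒undC≡0 e ¬ep)

incident⇒1≤weight : ∀ v e → T (incident v e) → 1 ≤ weight v e
incident⇒1≤weight v (dir x y) t with x ≡ᵇ v | y ≡ᵇ v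
... | true  | true  = s≤s z≤n
... | true  | false = s≤s z≤n
... | false | true  = s≤s z≤n
... | false | false = ⊥-elim t
incident⇒1≤weight v (und x y) t with x ≡ᵇ v | y ≡ᵇ v
... | true  | true  = s≤s z≤n
... | true  | false = s≤s z≤n
... | false | true  = s≤s z≤n
... | false | false = ⊥-elim t

Joins : Edge → ℕ → ℕ → Set
Joins e u v = e ≡ dir u v ⊎ e ≡ dir v u ⊎ e ≡ und u v ⊎ e ≡ und v u

weight≡1⇒joins : ∀ v e → weight v e ≡ 1 → Σ ℕ λ u → u ≢ v × Joins e u v
weight≡1⇒joins v (dir x y) w≡1
  with x ≡ᵇ v | ≡ᵇ-reflects-≡ x v | y ≡ᵇ v | ≡ᵇ-reflects-≡ y v
... | true  | ofʸ refl | false | ofⁿ y≢v = y , y≢v , inj₂ (inj₁ refl)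
... | false | ofⁿ x≢v | true  | ofʸ refl = x , x≢v , inj₁ refl
... | true  | _        | true  | _        = contradiction w≡1 λ ()
... | false | _        | false | _        = contradiction w≡1 λ ()
weight≡1⇒joins v (und x y) w≡1
  with x ≡ᵇ v | ≡ᵇ-reflects-≡ x v | y ≡ᵇ v | ≡ᵇ-reflects-≡ y v
... | true  | ofʸ refl | false | ofⁿ y≢v = y , y≢v , inj₂ (inj₂ (inj₂ refl))
... | false | ofⁿ x≢v | true  | ofʸ refl = x , x≢v , inj₂ (inj₂ (inj₁ refl))
... | true  | _        | true  | _        = contradiction w≡1 λ ()
... | false | _        | false | _        = contradiction w≡1 λ ()

edgesAt : List Edge → ℕ → List Edge
edgesAt E v = filterᵇ (incident v) E

∈-edgesAt⁺ : ∀ {v e E} → e ∈ E → Endpoint v e → e ∈ edgesAt E v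
∈-edgesAt⁺ {v} = ∈-filterᵇ⁺ (incident-reflects v)

∈-edgesAt⁻ : ∀ {v e E} → e ∈ edgesAt E v → e ∈ E × Endpoint v e
∈-edgesAt⁻ {v} = ∈-filterᵇ⁻ (incident-reflects v)

count-edgesAt : ∀ f v E → (∀ e → ¬ Endpoint v e → f e ≡ 0) → count f E ≡ count f (edgesAt E v)
count-edgesAt f v E f≡0 = begin
  count f E                                                   ≡⟨ count-filterᵇ f (incident v) E ⟩
  count f (edgesAt E v) + count f (filterᵇ (not ∘ incident v) E)
    ≡⟨ cong (count f (edgesAt E v) +_) (≡0⇒count≡0 f (filterᵇ (not ∘ incident v) E) λ e e∈ →
         f≡0 e (proj₂ (∈-filterᵇ⁻ (¬incident-reflects v) {xs = E} e∈))) ⟩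
  count f (edgesAt E v) + 0                                   ≡⟨ +-identityʳ _ ⟩
  count f (edgesAt E v)                                       ∎
  where open ≡-Reasoning

degrees-edgesAt : ∀ E v → degrees E v ≡ degrees (edgesAt E v) v
degrees-edgesAt E v = cong₂ _,_ (count-edgesAt (inC v) v E ¬endpoint⇒inC≡0)
  (cong₂ _,_ (count-edgesAt (outC v) v E ¬endpoint⇒outC≡0) (count-edgesAt (undC v) v E ¬endpoint⇒undC≡0))

deg≡count-weight-edgesAt : ∀ {n} (N : Net n) v → deg N v ≡ count (weight v) (edgesAt (edges N) v)
deg≡count-weight-edgesAt N v =
  trans (deg≡count-weight N v) (count-edgesAt (weight v) v (edges N) ¬endpoint⇒weight≡0)

edgesAt-weight-pos : ∀ {v e} E → e ∈ edgesAt E v → 1 ≤ weight v e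
edgesAt-weight-pos {v} {e} E e∈ =
  incident⇒1≤weight v e (reflects-fromWitness (incident-reflects v e) (proj₂ (∈-edgesAt⁻ {E = E} e∈)))

pair-degrees : ∀ {E v e d} → IsPair (edgesAt E v) e d
  → degrees E v ≡ (inC v e + inC v d , outC v e + outC v d , undC v e + undC v d)
pair-degrees {E} {v} pair = trans (degrees-edgesAt E v)
  (cong₂ _,_ (count-pair (inC v) pair) (cong₂ _,_ (count-pair (outC v) pair) (count-pair (undC v) pair)))

weight-out : ∀ {v w} → w ≢ v → weight v (dir v w) ≡ 1
weight-out {v} w≢v rewrite b2n-refl v | b2n-≢ w≢v = refl

data DegreeStep : Degrees → Degrees → Set where
  same     : ∀ {t} → DegreeStep t t
  undToOut : ∀ {i o u} → DegreeStep (i , o , suc u) (i , suc o , u)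

undToOut′ : ∀ {i o u i′ o′ u′} → i′ ≡ i → o′ ≡ suc o → u ≡ suc u′
  → DegreeStep (i , o , u) (i′ , o′ , u′)
undToOut′ refl refl refl = undToOut

≡⇒step : ∀ {t t′} → t′ ≡ t → DegreeStep t t′
≡⇒step refl = same

same-step : ∀ {t t′ t″} → t′ ≡ t → DegreeStep t′ t″ → DegreeStep t t″
same-step refl s = s

step-same : ∀ {t t′ t″} → DegreeStep t t′ → t″ ≡ t′ → DegreeStep t t″
step-same s refl = s

step-no-und : ∀ {i o t′} → DegreeStep (i , o , 0) t′ → t′ ≡ (i , o , 0)
step-no-und same = refl

step-binary : ∀ {t t′} → DegreeStep t t′ → BinaryDegrees t → BinaryDegrees t′
step-binary same b = b
step-binary (undToOut {i} {o} {u}) (_ , _ , inner) = (λ _ → inj₂ (inj₂ deg≡3)) , (λ ()) , λ _ _ → deg≡3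
  where
  deg≡3 : i + suc o + u ≡ 3
  deg≡3 = trans (cong (_+ u) (+-suc i o)) (trans (sym (+-suc (i + o) u)) (inner (λ ()) (λ ())))

step-leaf⁻ : ∀ {t t′} → DegreeStep t t′ → LeafDegrees t′ → LeafDegrees t × proj₁ t′ ≤ proj₁ t
step-leaf⁻ same     leaf = leaf , ≤-refl
step-leaf⁻ undToOut (() , _)

step-leaf⁺ : ∀ {t t′} → DegreeStep t t′ → LeafDegrees t → LeafDegrees t′
step-leaf⁺ same leaf = leaf
step-leaf⁺ undToOut (_ , ())

incIn incOut : Degrees → Degrees
incIn  (i , o , u) = suc i , o , u
incOut (i , o , u) = i , suc o , u

total-incOut : ∀ t → total (incOut t) ≡ suc (total t)
total-incOut (i , o , u) = cong (_+ u) (+-suc i o)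

binary-without-child : ∀ {t t′} → BinaryDegrees t → t ≡ incOut t′ → total t′ ≡ 1 ⊎ total t′ ≡ 2
binary-without-child {t′ = t′} binary refl with binary-nonleaf binary (λ ())
... | inj₁ deg≡0        = contradiction (trans (sym (total-incOut t′)) deg≡0) λ ()
... | inj₂ (inj₁ deg≡2) = inj₁ (suc-injective (trans (sym (total-incOut t′)) deg≡2))
... | inj₂ (inj₂ deg≡3) = inj₂ (suc-injective (trans (sym (total-incOut t′)) deg≡3))

incIn-injective : ∀ {t i o u} → incIn t ≡ (suc i , o , u) → t ≡ (i , o , u)
incIn-injective {_ , _ , _} refl = refl

parent-removed-from-leaf : ∀ {t t′} → t ≡ incIn t′ → LeafDegrees t → proj₁ t ≤ 1 → t′ ≡ (0 , 0 , 0)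
parent-removed-from-leaf {t′ = _ , _ , _} refl (refl , refl) (s≤s z≤n) = refl

record Removes (E : List Edge) (d : Edge) (E′ : List Edge) : Set where
  field count-removes : ∀ f → count f E ≡ f d + count f E′

open Removes public

module _ {E d E′} (removes : Removes E d E′) where

  removes-¬endpoint : ∀ {x} → ¬ Endpoint x d → degrees E′ x ≡ degrees E x
  removes-¬endpoint ¬ep = sym (cong₂ _,_ (unchanged (¬endpoint⇒inC≡0 d ¬ep))
    (cong₂ _,_ (unchanged (¬endpoint⇒outC≡0 d ¬ep)) (unchanged (¬endpoint⇒undC≡0 d ¬ep))))
    where
    unchanged : ∀ {f} → f d ≡ 0 → count f E ≡ count f E′
    unchanged {f} fd≡0 = trans (count-removes removes f) (cong (_+ count f E′) fd≡0)

module _ {E s t E′} (removes : Removes E (dir s t) E′) (t≢s : t ≢ s) where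

  removes-head : degrees E t ≡ incIn (degrees E′ t)
  removes-head
    rewrite count-removes removes (inC t) | count-removes removes (outC t) | count-removes removes (undC t)
          | ≡ᵇ-refl t | b2n-≢ (t≢s ∘ sym) = refl

  removes-tail : degrees E s ≡ incOut (degrees E′ s)
  removes-tail
    rewrite count-removes removes (inC s) | count-removes removes (outC s) | count-removes removes (undC s)
          | ≡ᵇ-refl s | b2n-≢ t≢s = refl

Enters : Edge → ℕ → ℕ → Set
Enters e u v = e ≡ dir u v ⊎ e ≡ und u v ⊎ e ≡ und v u

joins⇒enters⊎out : ∀ {e u v} → Joins e u v → Enters e u v ⊎ e ≡ dir v u
joins⇒enters⊎out (inj₁ e≡)               = inj₁ (inj₁ e≡)
joins⇒enters⊎out (inj₂ (inj₁ e≡))        = inj₂ e≡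
joins⇒enters⊎out (inj₂ (inj₂ (inj₁ e≡))) = inj₁ (inj₂ (inj₁ e≡))
joins⇒enters⊎out (inj₂ (inj₂ (inj₂ e≡))) = inj₁ (inj₂ (inj₂ e≡))

module _ {u v x : ℕ} (x≢v : x ≢ v) where

  enters-inC≡0 : ∀ {e} → Enters e u v → inC x e ≡ 0
  enters-inC≡0 (inj₁ refl) = b2n-≢ (x≢v ∘ sym)
  enters-inC≡0 (inj₂ (inj₁ refl)) = refl
  enters-inC≡0 (inj₂ (inj₂ refl)) = refl

  enters-outC : ∀ {e} → Enters e u v → x ≢ u ⊎ e ≡ dir u v → outC x e ≡ b2n (u ≡ᵇ x)
  enters-outC (inj₁ refl)        _           = refl
  enters-outC (inj₂ (inj₁ refl)) (inj₁ x≢u) = sym (b2n-≢ (x≢u ∘ sym))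
  enters-outC (inj₂ (inj₂ refl)) (inj₁ x≢u) = sym (b2n-≢ (x≢u ∘ sym))

  enters-undC≡0 : ∀ {e} → Enters e u v → x ≢ u ⊎ e ≡ dir u v → undC x e ≡ 0
  enters-undC≡0 (inj₁ refl)        _           = refl
  enters-undC≡0 (inj₂ (inj₁ refl)) (inj₁ x≢u) = cong₂ _+_ (b2n-≢ (x≢u ∘ sym)) (b2n-≢ (x≢v ∘ sym))
  enters-undC≡0 (inj₂ (inj₂ refl)) (inj₁ x≢u) = cong₂ _+_ (b2n-≢ (x≢v ∘ sym)) (b2n-≢ (x≢u ∘ sym))

module _ {u v : ℕ} (u≢v : u ≢ v) where

  undirected-outC≡0 : ∀ {e} → e ≡ und u v ⊎ e ≡ und v u → outC u e ≡ 0
  undirected-outC≡0 (inj₁ refl) = refl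
  undirected-outC≡0 (inj₂ refl) = refl

  undirected-undC≡1 : ∀ {e} → e ≡ und u v ⊎ e ≡ und v u → undC u e ≡ 1
  undirected-undC≡1 (inj₁ refl) = cong₂ _+_ (b2n-refl u) (b2n-≢ (u≢v ∘ sym))
  undirected-undC≡1 (inj₂ refl) = cong₂ _+_ (b2n-≢ (u≢v ∘ sym)) (b2n-refl u)

-- E′ is E with the path u — e — v → w replaced by the edge u → w
record Bypasses (E E′ : List Edge) (e : Edge) (u v w : ℕ) : Set where
  field count-bypasses : ∀ f → count f E + f (dir u w) ≡ count f E′ + (f e + f (dir v w))

open Bypasses public

module _ {E E′ e u v w} (bypasses : Bypasses E E′ e u v w) where

  private
    unchanged : ∀ f → f (dir u w) ≡ f e + f (dir v w) → count f E′ ≡ count f E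
    unchanged f eq = sym (+-cancelʳ-≡ (f (dir u w)) (count f E) (count f E′)
                           (trans (count-bypasses bypasses f) (cong (count f E′ +_) (sym eq))))

    out-suc : outC u e ≡ 0 → outC u (dir v w) ≡ 0 → count (outC u) E′ ≡ suc (count (outC u) E)
    out-suc e≡0 vw≡0 = begin
      count (outC u) E′                                 ≡⟨ sym (+-identityʳ _) ⟩
      count (outC u) E′ + 0
        ≡⟨ cong (count (outC u) E′ +_) (sym (cong₂ _+_ e≡0 vw≡0)) ⟩
      count (outC u) E′ + (outC u e + outC u (dir v w)) ≡⟨ sym (count-bypasses bypasses (outC u)) ⟩
      count (outC u) E + b2n (u ≡ᵇ u)                   ≡⟨ cong (count (outC u) E +_) (b2n-refl u) ⟩
      count (outC u) E + 1                              ≡⟨ +-comm _ 1 ⟩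
      suc (count (outC u) E)                            ∎
      where open ≡-Reasoning

    und-suc : undC u e ≡ 1 → count (undC u) E ≡ suc (count (undC u) E′)
    und-suc e≡1 = begin
      count (undC u) E                   ≡⟨ sym (+-identityʳ _) ⟩
      count (undC u) E + 0               ≡⟨ count-bypasses bypasses (undC u) ⟩
      count (undC u) E′ + (undC u e + 0) ≡⟨ cong (λ k → count (undC u) E′ + (k + 0)) e≡1 ⟩
      count (undC u) E′ + 1              ≡⟨ +-comm _ 1 ⟩
      suc (count (undC u) E′)            ∎
      where open ≡-Reasoning

  bypass-same : ∀ {x} → Enters e u v → x ≢ v → x ≢ u ⊎ e ≡ dir u v → degrees E′ x ≡ degrees E x
  bypass-same {x} enters x≢v away = cong₂ _,_ (unchanged (inC x) in-eq)
    (cong₂ _,_ (unchanged (outC x) out-eq) (unchanged (undC x) und-eq))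
    where
    in-eq : b2n (w ≡ᵇ x) ≡ inC x e + b2n (w ≡ᵇ x)
    in-eq = cong (_+ b2n (w ≡ᵇ x)) (sym (enters-inC≡0 x≢v enters))
    out-eq : b2n (u ≡ᵇ x) ≡ outC x e + b2n (v ≡ᵇ x)
    out-eq rewrite b2n-≢ (x≢v ∘ sym) | enters-outC x≢v enters away = sym (+-identityʳ _)
    und-eq : 0 ≡ undC x e + 0
    und-eq = cong (_+ 0) (sym (enters-undC≡0 x≢v enters away))

  bypass-step : ∀ {x} → Enters e u v → u ≢ v → x ≢ v → DegreeStep (degrees E x) (degrees E′ x)
  bypass-step {x} enters u≢v x≢v with x ≟ u
  ... | no x≢u = ≡⇒step (bypass-same enters x≢v (inj₁ x≢u))
  ... | yes refl = at-u enters
    where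
    at-u : Enters e u v → DegreeStep (degrees E u) (degrees E′ u)
    at-u (inj₁ directed)   = ≡⇒step (bypass-same enters u≢v (inj₂ directed))
    at-u (inj₂ undirected) = undToOut′
      (unchanged (inC u) (cong (_+ b2n (w ≡ᵇ u)) (sym (enters-inC≡0 u≢v enters))))
      (out-suc (undirected-outC≡0 u≢v undirected) (b2n-≢ (u≢v ∘ sym)))
      (und-suc (undirected-undC≡1 u≢v undirected))

module _ {n : ℕ} {N : Net n} {v : ℕ} where

  ∈-deleteNode⁻ : ∀ {x} → x ∈ nodes (deleteNode v N) → x ∈ nodes N × x ≢ v
  ∈-deleteNode⁻ = ∈-filterᵇ⁻ (≢-reflects v)

  ∈-deleteNode⁺ : ∀ {x} → x ∈ nodes N → x ≢ v → x ∈ nodes (deleteNode v N)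
  ∈-deleteNode⁺ = ∈-filterᵇ⁺ (≢-reflects v)

  ∈-deleteNode-edges⁻ : ∀ {e} → e ∈ edges (deleteNode v N) → e ∈ edges N × ¬ Endpoint v e
  ∈-deleteNode-edges⁻ = ∈-filterᵇ⁻ (¬incident-reflects v)

  ∈-deleteNode-edges⁺ : ∀ {e} → e ∈ edges N → ¬ Endpoint v e → e ∈ edges (deleteNode v N)
  ∈-deleteNode-edges⁺ = ∈-filterᵇ⁺ (¬incident-reflects v)

  deleteNode-wellFormed : WellFormed N → WellFormed (deleteNode v N)
  deleteNode-wellFormed (unique , endsIn) = Unique.filter⁺ (T? ∘ λ x → not (x ≡ᵇ v)) unique , λ e e∈ →
    let (e∈N , ¬ep)     = ∈-deleteNode-edges⁻ e∈
        (end₁∈ , end₂∈) = endsIn e e∈N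
    in ∈-deleteNode⁺ end₁∈ (¬ep ∘ inj₁) , ∈-deleteNode⁺ end₂∈ (¬ep ∘ inj₂)

  ∈-suppress-edges⁺ : ∀ {e} → e ∈ edges N → ¬ Endpoint v e → e ∈ edges (suppress v N)
  ∈-suppress-edges⁺ e∈ ¬ep = ∈-++⁺ʳ (bridge v (edgesAt (edges N) v)) (∈-deleteNode-edges⁺ e∈ ¬ep)

  deleteNode-removes : ∀ {d} → edgesAt (edges N) v ≡ d ∷ [] → Removes (edges N) d (edges (deleteNode v N))
  deleteNode-removes {d} star .count-removes f = begin
    count f (edges N)                            ≡⟨ count-filterᵇ f (incident v) (edges N) ⟩
    count f (edgesAt (edges N) v) + count f rest ≡⟨ cong (λ L → count f L + count f rest) star ⟩
    f d + 0 + count f rest                       ≡⟨ cong (_+ count f rest) (+-identityʳ (f d)) ⟩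
    f d + count f rest                           ∎
    where
    open ≡-Reasoning
    rest : List Edge
    rest = edges (deleteNode v N)

module _ {n : ℕ} (N : Net n) {d : Edge} (d∈ : d ∈ edges N) where

  removeEdge-wellFormed : WellFormed N → WellFormed (removeEdge N d∈)
  removeEdge-wellFormed (unique , endsIn) = unique , λ e → endsIn e ∘ ∈-─⁻ (edges N) d∈

  removeEdge-removes : Removes (edges N) d (edges (removeEdge N d∈))
  removeEdge-removes .count-removes f = count-─ f (edges N) d∈

module _ {n : ℕ} where

  record Shrinks (D : Edge → Set) (N M : Net n) : Set where
    field
      wellFormed : WellFormed M
      embedding  : Embedding D (edges M) (edges N)
      nodes⊆     : ∀ {v} → v ∈ nodes M → v ∈ nodes N
      labels     : lab M ≡ lab N

  module _ {D : Edge → Set} where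

    shrinks-refl : ∀ {N : Net n} → WellFormed N → Shrinks D N N
    shrinks-refl {N} wf = record
      { wellFormed = wf ; embedding = embedding-refl (edges N) ; nodes⊆ = λ v∈ → v∈ ; labels = refl }

    shrinks-trans : ∀ {N M K : Net n} → Shrinks D N M → Shrinks D M K → Shrinks D N K
    shrinks-trans N⇝M M⇝K = record
      { wellFormed = M⇝K.wellFormed
      ; embedding  = embedding-trans M⇝K.embedding N⇝M.embedding
      ; nodes⊆     = N⇝M.nodes⊆ ∘ M⇝K.nodes⊆
      ; labels     = trans M⇝K.labels N⇝M.labels
      }
      where
      module N⇝M = Shrinks N⇝M
      module M⇝K = Shrinks M⇝K

    removeEdge-shrinks : ∀ {N : Net n} {d} (d∈ : d ∈ edges N) → WellFormed N → Shrinks D N (removeEdge N d∈)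
    removeEdge-shrinks {N} d∈ wf = record
      { wellFormed = removeEdge-wellFormed N d∈ wf
      ; embedding  = embedding-─ (edges N) d∈
      ; nodes⊆     = λ v∈ → v∈
      ; labels     = refl
      }

    deleteNode-shrinks : ∀ {N : Net n} {v} → WellFormed N → Shrinks D N (deleteNode v N)
    deleteNode-shrinks {N} {v} wf = record
      { wellFormed = deleteNode-wellFormed {N = N} wf
      ; embedding  = embedding-filterᵇ (not ∘ incident v) (edges N)
      ; nodes⊆     = proj₁ ∘ ∈-deleteNode⁻ {N = N}
      ; labels     = refl
      }

    suppress-shrinks : ∀ {N : Net n} {v} → WellFormed N
      → (∀ {e} → e ∈ bridge v (edgesAt (edges N) v)
           → D e × end₁ e ∈ nodes (deleteNode v N) × end₂ e ∈ nodes (deleteNode v N))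
      → Shrinks D N (suppress v N)
    suppress-shrinks {N} {v} wf bridged = record
      { wellFormed = proj₁ (deleteNode-wellFormed {N = N} {v} wf) , endsIn
      ; embedding  = embedding-++ (bridge v (edgesAt (edges N) v)) (proj₁ ∘ bridged) (Shrinks.embedding deleted)
      ; nodes⊆     = Shrinks.nodes⊆ deleted
      ; labels     = refl
      }
      where
      deleted : Shrinks D N (deleteNode v N)
      deleted = deleteNode-shrinks {N} {v} wf
      endsIn : ∀ e → e ∈ edges (suppress v N) → end₁ e ∈ nodes (suppress v N) × end₂ e ∈ nodes (suppress v N)
      endsIn e e∈ with ∈-++⁻ (bridge v (edgesAt (edges N) v)) e∈
      ... | inj₁ e∈bridge = proj₂ (bridged e∈bridge)
      ... | inj₂ e∈rest   = proj₂ (deleteNode-wellFormed {N = N} wf) e e∈rest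

bridge-pair : ∀ {v u w e} L → u ≢ v → Enters e u v → IsPair L e (dir v w) → bridge v L ≡ dir u w ∷ []
bridge-pair {v} _ u≢v (inj₁ refl)        (inj₁ refl) rewrite ≡ᵇ-refl v | ≢⇒≡ᵇ≡false u≢v = refl
bridge-pair {v} _ u≢v (inj₂ (inj₁ refl)) (inj₁ refl) rewrite ≡ᵇ-refl v | ≢⇒≡ᵇ≡false u≢v = refl
bridge-pair {v} _ u≢v (inj₂ (inj₂ refl)) (inj₁ refl) rewrite ≡ᵇ-refl v = refl
bridge-pair {v} _ u≢v (inj₁ refl)        (inj₂ refl) rewrite ≡ᵇ-refl v | ≢⇒≡ᵇ≡false u≢v = refl
bridge-pair {v} _ u≢v (inj₂ (inj₁ refl)) (inj₂ refl) rewrite ≡ᵇ-refl v | ≢⇒≡ᵇ≡false u≢v = refl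
bridge-pair {v} _ u≢v (inj₂ (inj₂ refl)) (inj₂ refl) rewrite ≡ᵇ-refl v = refl

module _ {n : ℕ} where

  enters-tail∈ : ∀ {N : Net n} {e u v} → WellFormed N → e ∈ edges N → Enters e u v → u ∈ nodes N
  enters-tail∈ (_ , endsIn) e∈ (inj₁ refl)        = proj₁ (endsIn _ e∈)
  enters-tail∈ (_ , endsIn) e∈ (inj₂ (inj₁ refl)) = proj₁ (endsIn _ e∈)
  enters-tail∈ (_ , endsIn) e∈ (inj₂ (inj₂ refl)) = proj₂ (endsIn _ e∈)

  Source : Net n → ℕ → ℕ → Set
  Source N v w = edgesAt (edges N) v ≡ dir v w ∷ []

  module _ {N : Net n} {v w : ℕ} (source : Source N v w) where

    source-edges : edges (suppress v N) ≡ edges (deleteNode v N)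
    source-edges rewrite source = refl

    source-removes : Removes (edges N) (dir v w) (edges (suppress v N))
    source-removes = subst (Removes (edges N) (dir v w)) (sym source-edges) (deleteNode-removes {N = N} source)

    source-shrinks : ∀ {D} → WellFormed N → Shrinks D N (suppress v N)
    source-shrinks wf = suppress-shrinks wf λ {e} e∈ →
      ⊥-elim (no-bridge (subst (λ L → e ∈ bridge v L) source e∈))
      where
      no-bridge : ∀ {e : Edge} → ¬ e ∈ []
      no-bridge ()

  record Through (N : Net n) (v u w : ℕ) : Set where
    field
      inEdge : Edge
      enters : Enters inEdge u v
      u≢v    : u ≢ v
      w≢v    : w ≢ v
      star   : IsPair (edgesAt (edges N) v) inEdge (dir v w)

  module _ {N : Net n} {v u w : ℕ} (through : Through N v u w) where

    open Through through

    through-edges : edges (suppress v N) ≡ dir u w ∷ edges (deleteNode v N)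
    through-edges = cong (_++ edges (deleteNode v N)) (bridge-pair _ u≢v enters star)

    through-bypasses : Bypasses (edges N) (edges (suppress v N)) inEdge u v w
    through-bypasses .count-bypasses f = begin
      count f (edges N) + f (dir u w)
        ≡⟨ cong (_+ f (dir u w)) (trans (count-filterᵇ f (incident v) (edges N))
                                        (cong (_+ count f rest) (count-pair f star))) ⟩
      f inEdge + f (dir v w) + count f rest + f (dir u w)
        ≡⟨ xy∙z≈zy∙x (f inEdge + f (dir v w)) (count f rest) (f (dir u w)) ⟩
      f (dir u w) + count f rest + (f inEdge + f (dir v w))
        ≡⟨ cong (λ L → count f L + (f inEdge + f (dir v w))) (sym through-edges) ⟩
      count f (edges (suppress v N)) + (f inEdge + f (dir v w)) ∎
      where
      open ≡-Reasoning
      rest : List Edge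
      rest = edges (deleteNode v N)

    through-shrinks : ∀ {D} → WellFormed N → D (dir u w) → Shrinks D N (suppress v N)
    through-shrinks {D} wf d = suppress-shrinks wf λ e∈ → bridged (subst (_ ∈_) (bridge-pair _ u≢v enters star) e∈)
      where
      u∈ : u ∈ nodes N
      u∈ = enters-tail∈ {N = N} wf (proj₁ (∈-edgesAt⁻ {E = edges N} (pair-∈ star))) enters
      w∈ : w ∈ nodes N
      w∈ = proj₂ (proj₂ wf _ (proj₁ (∈-edgesAt⁻ {E = edges N} (pair-∈ʳ star))))
      bridged : ∀ {e} → e ∈ dir u w ∷ [] → D e × end₁ e ∈ nodes (deleteNode v N) × end₂ e ∈ nodes (deleteNode v N)
      bridged (here refl) = d , ∈-deleteNode⁺ {N = N} u∈ u≢v , ∈-deleteNode⁺ {N = N} w∈ w≢v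

    through-same : ∀ {x} → x ≢ v → x ≢ u ⊎ inEdge ≡ dir u v
      → degrees (edges (suppress v N)) x ≡ degrees (edges N) x
    through-same = bypass-same through-bypasses enters

    through-step : ∀ {x} → x ≢ v → DegreeStep (degrees (edges N) x) (degrees (edges (suppress v N)) x)
    through-step = bypass-step through-bypasses enters u≢v

module _ {n : ℕ} {N : Net n} {w : ℕ} (leaf : IsLeaf N w) where

  leaf-¬trav : ∀ {e t} → e ∈ edges N → ¬ Trav e w t
  leaf-¬trav e∈ tdir  = 1+n≢0 (trans (sym (b2n-refl w)) (count≡0⇒≡0 (outC w) (proj₁ leaf) e∈))
  leaf-¬trav e∈ tund₁ = 1+n≢0 (trans (sym (b2n-refl w)) (m+n≡0⇒m≡0 _ (count≡0⇒≡0 (undC w) (proj₂ leaf) e∈)))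
  leaf-¬trav e∈ tund₂ = 1+n≢0 (trans (sym (b2n-refl w)) (m+n≡0⇒n≡0 _ (count≡0⇒≡0 (undC w) (proj₂ leaf) e∈)))

  leaf-¬out : ∀ {t} → ¬ dir w t ∈ edges N
  leaf-¬out e∈ = leaf-¬trav e∈ tdir

  leaf-edges-incoming : ∀ e → e ∈ edges N → incident w e ≡ true → Σ ℕ λ x → e ≡ dir x w
  leaf-edges-incoming e e∈ inc = from-endpoint e e∈ (reflects-toWitness (incident-reflects w e) (subst T (sym inc) tt))
    where
    from-endpoint : ∀ e → e ∈ edges N → Endpoint w e → Σ ℕ λ x → e ≡ dir x w
    from-endpoint (dir x _) e∈ (inj₂ refl) = x , refl
    from-endpoint (dir _ _) e∈ (inj₁ refl) = ⊥-elim (leaf-¬trav e∈ tdir)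
    from-endpoint (und _ _) e∈ (inj₁ refl) = ⊥-elim (leaf-¬trav e∈ tund₁)
    from-endpoint (und _ _) e∈ (inj₂ refl) = ⊥-elim (leaf-¬trav e∈ tund₂)

fromℕ-or-inject₁ : ∀ {m} (i : Fin (suc m)) → i ≡ fromℕ m ⊎ Σ (Fin m) λ k → i ≡ inject₁ k
fromℕ-or-inject₁ {zero}  fzero    = inj₁ refl
fromℕ-or-inject₁ {suc m} fzero    = inj₂ (fzero , refl)
fromℕ-or-inject₁ {suc m} (fsuc i) with fromℕ-or-inject₁ i
... | inj₁ refl       = inj₁ refl
... | inj₂ (k , refl) = inj₂ (fsuc k , refl)

module _ {n : ℕ} where

  IntoLeaf : Net n → Edge → Set
  IntoLeaf M e = Σ ℕ λ u → Σ ℕ λ w → e ≡ dir u w × IsLeaf M w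

  cycle-continues : ∀ {M : Net n} ((m , vs , es , _) : SemidirectedCycle M) (i : Fin (suc m))
    → Σ ℕ λ t → Σ (Fin (suc m)) λ j → Trav (lookup (edges M) (es j)) (vs (fsuc i)) t
  cycle-continues {M} (m , vs , es , closed , _ , _ , travs) i with fromℕ-or-inject₁ i
  ... | inj₁ refl       =
    _ , fzero , subst (λ x → Trav (lookup (edges M) (es fzero)) x (vs (fsuc fzero))) (sym closed) (travs fzero)
  ... | inj₂ (k , refl) = _ , fsuc k , travs (fsuc k)

  cycle-¬intoLeaf : ∀ {M : Net n} ((m , vs , es , _) : SemidirectedCycle M)
    → ∀ i → ¬ IntoLeaf M (lookup (edges M) (es i))
  cycle-¬intoLeaf {M} c@(m , vs , es , _ , _ , _ , travs) i (u , w , eq , leaf) with cycle-continues {M} c i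
  ... | t , j , trav =
    leaf-¬trav {N = M} leaf (∈-lookup (es j)) (subst (λ x → Trav (lookup (edges M) (es j)) x t) (sym w≡next) trav)
    where
    w≡next : w ≡ vs (fsuc i)
    w≡next = head (subst (λ e → Trav e (vs (inject₁ i)) (vs (fsuc i))) eq (travs i))
      where
      head : ∀ {x y} → Trav (dir u w) x y → w ≡ y
      head tdir = refl

  embedding-sdag : ∀ {D} {N M : Net n} → Embedding D (edges M) (edges N)
    → (∀ {e} → e ∈ edges M → D e → IntoLeaf M e) → IsSDAG N → IsSDAG M
  embedding-sdag {D} {N} {M} emb intoLeaf sdag c@(m , vs , es , closed , vs-inj , es-inj , travs) =
    sdag (m , vs , es′ , closed , vs-inj , es′-inj , es′-travs)
    where
    ¬new : ∀ i → ¬ D (lookup (edges M) (es i))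
    ¬new i = cycle-¬intoLeaf {M} c i ∘ intoLeaf (∈-lookup (es i))
    es′ : Fin (suc m) → Fin (length (edges N))
    es′ i = embed-index emb (es i) (¬new i)
    es′-inj : ∀ {i j} → es′ i ≡ es′ j → i ≡ j
    es′-inj {i} {j} eq = es-inj (embed-index-injective emb (es i) (es j) (¬new i) (¬new j) eq)
    es′-travs : ∀ i → Trav (lookup (edges N) (es′ i)) (vs (inject₁ i)) (vs (fsuc i))
    es′-travs i =
      subst (λ e → Trav e (vs (inject₁ i)) (vs (fsuc i))) (sym (lookup-embed-index emb (es i) (¬new i))) (travs i)

  loop⇒cycle : ∀ {N : Net n} {v} → dir v v ∈ edges N → SemidirectedCycle N
  loop⇒cycle {v = v} v→v = 0 , (λ _ → v) , (λ _ → index v→v) , refl , fin1-inj , fin1-inj ,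
    λ _ → subst (λ e → Trav e v v) (lookup-index v→v) tdir
    where
    fin1-inj : ∀ {A : Set} {f : Fin 1 → A} {i j : Fin 1} → f i ≡ f j → i ≡ j
    fin1-inj {i = fzero} {fzero} _ = refl

module _ {n : ℕ} where

  data NewLeafEdge (N : Net n) : Edge → Set where
    newLeafEdge : ∀ {p u w} → dir p w ∈ edges N → IsLeaf N w → NewLeafEdge N (dir u w)

  record CompatibleAt (N M : Net n) (v : ℕ) : Set where
    field
      binary : BinaryDegrees (degrees (edges M) v)
      leaf⁻  : IsLeaf M v → IsLeaf N v × degIn M v ≤ degIn N v
      leaf⁺  : IsLeaf N v → IsLeaf M v

  module _ {N M : Net n} {v : ℕ} where

    compatible-step : IsBinary N → v ∈ nodes N → DegreeStep (degrees (edges N) v) (degrees (edges M) v)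
      → CompatibleAt N M v
    compatible-step binN v∈ change = record
      { binary = step-binary change (binN v v∈) ; leaf⁻ = step-leaf⁻ change ; leaf⁺ = step-leaf⁺ change }

    compatible-root : ¬ IsLeaf N v → degrees (edges M) v ≡ (0 , 2 , 0) → CompatibleAt N M v
    compatible-root ¬leaf eq = record
      { binary = subst BinaryDegrees (sym eq)
                   ((λ _ → inj₂ (inj₁ refl)) , (λ ()) , λ root _ → contradiction (refl , refl) root)
      ; leaf⁻  = λ leaf → contradiction (proj₁ (subst LeafDegrees eq leaf)) λ ()
      ; leaf⁺  = λ leaf → contradiction leaf ¬leaf
      }

    compatible-isolated : IsLeaf N v → degrees (edges M) v ≡ (0 , 0 , 0) → CompatibleAt N M v
    compatible-isolated leaf eq = record
      { binary = subst BinaryDegrees (sym eq)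
                   ((λ _ → inj₁ refl) , (λ _ → inj₁ refl) , λ root _ → contradiction (refl , refl) root)
      ; leaf⁻  = λ _ → leaf , subst (λ t → proj₁ t ≤ degIn N v) (sym eq) z≤n
      ; leaf⁺  = λ _ → subst LeafDegrees (sym eq) (refl , refl)
      }

  module _ {N M : Net n} (shrinks : Shrinks (NewLeafEdge N) N M) where

    open Shrinks shrinks

    upath-transfer : ∀ {y z} → UPath (edges M) y z → UPath (edges N) y z
    upath-transfer here = here
    upath-transfer (step (inj₁ e∈) path) with embedding-∈ embedding e∈
    ... | inj₂ e∈N = step (inj₁ e∈N) (upath-transfer path)
    upath-transfer (step (inj₂ e∈) path) with embedding-∈ embedding e∈
    ... | inj₂ e∈N = step (inj₂ e∈N) (upath-transfer path)

    reduction-complete : IsCompleteBinaryLNetwork N → (∀ {v} → v ∈ nodes M → CompatibleAt N M v)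
      → IsCompleteBinaryLNetwork M
    reduction-complete ((_ , sdagN , treeN , labelledN , injectiveN) , _ , _ , closedN) compatible =
        (wellFormed , sdag , tree , labelled , injective)
      , (λ v v∈ → CompatibleAt.binary (compatible v∈))
      , (λ ℓ _ leaf → leaf-edges-incoming {N = M} leaf)
      , closed
      where
      leaf⁻ : ∀ {v} → v ∈ nodes M → IsLeaf M v → IsLeaf N v
      leaf⁻ v∈ = proj₁ ∘ CompatibleAt.leaf⁻ (compatible v∈)
      sdag : IsSDAG M
      sdag = embedding-sdag {N = N} {M} embedding intoLeaf sdagN
        where
        intoLeaf : ∀ {e} → e ∈ edges M → NewLeafEdge N e → IntoLeaf M e
        intoLeaf e∈ (newLeafEdge {u = u} {w} _ leaf) =
          u , w , refl , CompatibleAt.leaf⁺ (compatible (proj₂ (proj₂ wellFormed _ e∈))) leaf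
      tree : ∀ v → v ∈ nodes M → IsLeaf M v → IsTreeNode M v
      tree v v∈ leaf =
        ≤-trans (proj₂ (CompatibleAt.leaf⁻ (compatible v∈) leaf)) (treeN v (nodes⊆ v∈) (leaf⁻ v∈ leaf))
      labelled : ∀ v → v ∈ nodes M → IsLeaf M v → Is-just (lab M v)
      labelled v v∈ leaf = subst (λ l → Is-just (l v)) (sym labels) (labelledN v (nodes⊆ v∈) (leaf⁻ v∈ leaf))
      injective : ∀ u v → u ∈ nodes M → v ∈ nodes M → IsLeaf M u → IsLeaf M v → lab M u ≡ lab M v → u ≡ v
      injective u v u∈ v∈ lu lv eq = injectiveN u v (nodes⊆ u∈) (nodes⊆ v∈) (leaf⁻ u∈ lu) (leaf⁻ v∈ lv)
        (subst (λ l → l u ≡ l v) labels eq)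
      closed : ∀ x y → dir x y ∈ edges M → ∀ z → UPath (edges M) y z → z ≡ y
      closed x y x→y z path with embedding-∈ embedding x→y
      ... | inj₁ (newLeafEdge p→y _) = closedN _ y p→y z (upath-transfer path)
      ... | inj₂ x→y∈N             = closedN x y x→y∈N z (upath-transfer path)

module _ {n : ℕ} {N : Net n} {v : ℕ} where

  outgoing⇒singletonRoot : (∀ {e} → e ∈ edgesAt (edges N) v → Σ ℕ λ t → e ≡ dir v t × t ≢ v)
    → SingletonRootComponent N v
  outgoing⇒singletonRoot outgoing = no-upath , no-parent
    where
    no-upath : ∀ z → UPath (edges N) v z → z ≡ v
    no-upath z here = refl
    no-upath z (step (inj₁ e∈) _) with outgoing (∈-edgesAt⁺ e∈ (inj₁ refl))
    ... | _ , () , _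
    no-upath z (step (inj₂ e∈) _) with outgoing (∈-edgesAt⁺ e∈ (inj₂ refl))
    ... | _ , () , _
    no-parent : ∀ x → ¬ dir x v ∈ edges N
    no-parent x e∈ with outgoing (∈-edgesAt⁺ e∈ (inj₂ refl))
    ... | _ , refl , t≢v = t≢v refl

  enters⇒¬singletonRoot : ∀ {e u} → Enters e u v → u ≢ v → e ∈ edges N → ¬ SingletonRootComponent N v
  enters⇒¬singletonRoot (inj₁ refl)        u≢v e∈ (_ , no-parent) = no-parent _ e∈
  enters⇒¬singletonRoot (inj₂ (inj₁ refl)) u≢v e∈ (no-upath , _)  = u≢v (no-upath _ (step (inj₂ e∈) here))
  enters⇒¬singletonRoot (inj₂ (inj₂ refl)) u≢v e∈ (no-upath , _)  = u≢v (no-upath _ (step (inj₁ e∈) here))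

  degree1-star : ∀ {d} → deg N v ≡ 1 → d ∈ edges N → Endpoint v d → edgesAt (edges N) v ≡ d ∷ []
  degree1-star deg≡1 d∈ ep = count≡1-∈⇒singleton (weight v) (edgesAt (edges N) v) (edgesAt-weight-pos (edges N))
    (trans (sym (deg≡count-weight-edgesAt N v)) deg≡1) (∈-edgesAt⁺ d∈ ep)

  degree2-star : ∀ {w} → deg N v ≡ 2 → dir v w ∈ edges N → w ≢ v
    → Σ ℕ λ u → Σ Edge λ e → u ≢ v × Joins e u v × IsPair (edgesAt (edges N) v) e (dir v w)
  degree2-star deg≡2 v→w w≢v
    with count≡2⇒pair (weight v) (edgesAt (edges N) v) (edgesAt-weight-pos (edges N))
           (trans (sym (deg≡count-weight-edgesAt N v)) deg≡2) (∈-edgesAt⁺ v→w (inj₁ refl)) (weight-out w≢v)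
  ... | e , we≡1 , pair with weight≡1⇒joins v e we≡1
  ...   | u , u≢v , joins = u , e , u≢v , joins , pair

  private
    two-children⇒singletonRoot : ∀ {u w} → u ≢ v → w ≢ v → IsPair (edgesAt (edges N) v) (dir v u) (dir v w)
      → SingletonRootComponent N v
    two-children⇒singletonRoot {u} {w} u≢v w≢v pair = outgoing⇒singletonRoot λ e∈ → child (∈-pair pair e∈)
      where
      child : ∀ {e} → e ≡ dir v u ⊎ e ≡ dir v w → Σ ℕ λ t → e ≡ dir v t × t ≢ v
      child (inj₁ refl) = _ , refl , u≢v
      child (inj₂ refl) = _ , refl , w≢v

  suppressible-shape : ∀ {w} → Suppressible N v → dir v w ∈ edges N → w ≢ v
    → Source N v w ⊎ Σ ℕ λ u → Through N v u w
  suppressible-shape (_ , _ , inj₂ (deg≡1 , _)) v→w _ = inj₁ (degree1-star deg≡1 v→w (inj₁ refl))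
  suppressible-shape (_ , _ , inj₁ (deg≡2 , ¬root)) v→w w≢v with degree2-star deg≡2 v→w w≢v
  ... | u , e , u≢v , joins , pair with joins⇒enters⊎out joins
  ...   | inj₁ enters = inj₂ (u , record { inEdge = e ; enters = enters ; u≢v = u≢v ; w≢v = w≢v ; star = pair })
  ...   | inj₂ refl   = contradiction (two-children⇒singletonRoot u≢v w≢v pair) ¬root

  out-edge⇒¬leaf : ∀ {w} → dir v w ∈ edges N → ¬ IsLeaf N v
  out-edge⇒¬leaf v→w leaf = leaf-¬out {N = N} leaf v→w

  star-∈ : ∀ {e d} → IsPair (edgesAt (edges N) v) e d → e ∈ edges N
  star-∈ = proj₁ ∘ ∈-edgesAt⁻ {E = edges N} ∘ pair-∈

  unsuppressible-degrees : ∀ {w} → ¬ Suppressible N v → v ∈ nodes N → dir v w ∈ edges N → w ≢ v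
    → IsTreeNode N w → deg N v ≡ 1 ⊎ deg N v ≡ 2 → degrees (edges N) v ≡ (0 , 2 , 0)
  unsuppressible-degrees {w} ¬supp v∈ v→w w≢v tree (inj₁ deg≡1) = contradiction suppressible ¬supp
    where
    only-child : ∀ {e} → e ∈ edgesAt (edges N) v → e ≡ dir v w
    only-child e∈ with subst (_ ∈_) (degree1-star deg≡1 v→w (inj₁ refl)) e∈
    ... | here refl = refl
    tree-child : ∀ c → dir v c ∈ edges N → IsTreeNode N c
    tree-child c v→c = subst (IsTreeNode N) (sym (cong end₂ (only-child (∈-edgesAt⁺ v→c (inj₁ refl))))) tree
    suppressible : Suppressible N v
    suppressible = v∈ , out-edge⇒¬leaf v→w
      , inj₂ (deg≡1 , outgoing⇒singletonRoot (λ e∈ → w , only-child e∈ , w≢v) , tree-child)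
  unsuppressible-degrees ¬supp v∈ v→w w≢v tree (inj₂ deg≡2) with degree2-star deg≡2 v→w w≢v
  ... | u , e , u≢v , joins , pair with joins⇒enters⊎out joins
  ...   | inj₁ enters = contradiction
          (v∈ , out-edge⇒¬leaf v→w , inj₁ (deg≡2 , enters⇒¬singletonRoot enters u≢v (star-∈ pair))) ¬supp
  ...   | inj₂ refl rewrite pair-degrees {E = edges N} pair | b2n-≢ u≢v | b2n-≢ w≢v | b2n-refl v = refl

  in-out-through : ∀ {w} → degrees (edges N) v ≡ (1 , 1 , 0) → dir v w ∈ edges N → w ≢ v
    → Σ ℕ λ u → Σ (Through N v u w) λ through → Through.inEdge through ≡ dir u v
  in-out-through degs v→w w≢v with degree2-star (cong total degs) v→w w≢v
  ... | u , e , u≢v , joins , pair with joins⇒enters⊎out joins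
  ...   | inj₁ (inj₁ refl) =
          u , record { inEdge = e ; enters = inj₁ refl ; u≢v = u≢v ; w≢v = w≢v ; star = pair } , refl
  ...   | inj₁ (inj₂ undirected) = contradiction
          (trans (sym (undirected-undC≡1 (u≢v ∘ sym) (Sum.swap undirected)))
                 (count≡0⇒≡0 (undC v) (cong (proj₂ ∘ proj₂) degs) (star-∈ pair)))
          λ ()
  ...   | inj₂ refl = contradiction
          (trans (cong (proj₁ ∘ proj₂) (trans (sym degs) (pair-degrees {E = edges N} pair)))
                 (cong₂ _+_ (b2n-refl v) (b2n-refl v)))
          λ ()

module _ {n : ℕ} where

  data ParentOutcome (N₀ M₁ : Net n) (p b v : ℕ) : Set where
    kept      : v ≢ p → DegreeStep (degrees (edges N₀) v) (degrees (edges M₁) v)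
              → ParentOutcome N₀ M₁ p b v
    deleted   : v ≡ p → ¬ v ∈ nodes M₁ → ParentOutcome N₀ M₁ p b v
    rootOfTwo : v ≡ p → degrees (edges M₁) v ≡ (0 , 2 , 0) → ParentOutcome N₀ M₁ p b v
    isolated  : v ≡ b → degrees (edges M₁) v ≡ (0 , 0 , 0) → ParentOutcome N₀ M₁ p b v

  record ParentSuppression (D : Edge → Set) (N₀ M₁ : Net n) (p b : ℕ) : Set where
    field
      shrinks : Shrinks D N₀ M₁
      outcome : ∀ v → ParentOutcome N₀ M₁ p b v
      edges⁺  : ∀ {e} → e ∈ edges N₀ → ¬ Endpoint p e → e ∈ edges M₁

  suppress-parent : ∀ {D} {N₀ M₁ : Net n} {p b} → WellFormed N₀ → dir p b ∈ edges N₀ → b ≢ p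
    → IsLeaf N₀ b → IsTreeNode N₀ b → deg N₀ p ≡ 1 ⊎ deg N₀ p ≡ 2 → (∀ u → D (dir u b))
    → SuppressIfSuppressible p N₀ M₁ → ParentSuppression D N₀ M₁ p b
  suppress-parent {D} {N₀} {p = p} {b} wf p→b b≢p leaf tree deg∈ _ (nosupp ¬supp) = record
    { shrinks = shrinks-refl {N = N₀} wf
    ; outcome = outcome
    ; edges⁺  = λ e∈ _ → e∈
    }
    where
    outcome : ∀ v → ParentOutcome N₀ N₀ p b v
    outcome v with v ≟ p
    ... | yes refl = rootOfTwo refl
      (unsuppressible-degrees {N = N₀} ¬supp (proj₁ (proj₂ wf _ p→b)) p→b b≢p tree deg∈)
    ... | no v≢p = kept v≢p same
  suppress-parent {D} {N₀} {p = p} {b} wf p→b b≢p leaf tree deg∈ new-edge (supp suppressible) = record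
    { shrinks = shrinks
    ; outcome = outcome
    ; edges⁺  = ∈-suppress-edges⁺ {N = N₀} {p}
    }
    where
    p∉ : ¬ p ∈ nodes (suppress p N₀)
    p∉ p∈ = proj₂ (∈-deleteNode⁻ {N = N₀} p∈) refl
    shape : Source N₀ p b ⊎ Σ ℕ λ u → Through N₀ p u b
    shape = suppressible-shape suppressible p→b b≢p
    shrinks : Shrinks D N₀ (suppress p N₀)
    shrinks with shape
    ... | inj₁ source        = source-shrinks source wf
    ... | inj₂ (u , through) = through-shrinks through wf (new-edge u)
    outcome : ∀ v → ParentOutcome N₀ (suppress p N₀) p b v
    outcome v with v ≟ p | shape
    ... | yes refl | _ = deleted refl p∉
    ... | no v≢p | inj₂ (_ , through) = kept v≢p (through-step through v≢p)
    ... | no v≢p | inj₁ source with v ≟ b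
    ...   | yes refl =
      isolated refl (parent-removed-from-leaf (removes-head (source-removes {N = N₀} source) b≢p) leaf tree)
    ...   | no v≢b =
      kept v≢p (≡⇒step (removes-¬endpoint (source-removes {N = N₀} source) (¬endpoint-dir v≢p v≢b)))

module _ {n : ℕ} where

  outcome-compatible : ∀ {N N₀ M₁ M : Net n} {p b v} → IsBinary N → v ∈ nodes N → v ∈ nodes M₁
    → ¬ IsLeaf N p → IsLeaf N b
    → (v ≢ p → degrees (edges N₀) v ≡ degrees (edges N) v) → degrees (edges M) v ≡ degrees (edges M₁) v
    → ParentOutcome N₀ M₁ p b v → CompatibleAt N M v
  outcome-compatible binN v∈N _ _ _ before after (kept v≢p change) =
    compatible-step binN v∈N (same-step (before v≢p) (step-same change after))
  outcome-compatible _ _ v∈M₁ _ _ _ _ (deleted refl v∉M₁) = contradiction v∈M₁ v∉M₁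
  outcome-compatible _ _ _ ¬leaf _ _ after (rootOfTwo refl degs) = compatible-root ¬leaf (trans after degs)
  outcome-compatible _ _ _ _ leaf _ after (isolated refl degs) = compatible-isolated leaf (trans after degs)

  outcome-without-und : ∀ {N₀ M₁ : Net n} {p b v i o} → v ≢ p → v ≢ b
    → degrees (edges N₀) v ≡ (i , o , 0) → ParentOutcome N₀ M₁ p b v → degrees (edges M₁) v ≡ (i , o , 0)
  outcome-without-und _   _   degs (kept _ change)   = step-no-und (subst (λ t → DegreeStep t _) degs change)
  outcome-without-und v≢p _   _    (deleted v≡p _)   = contradiction v≡p v≢p
  outcome-without-und v≢p _   _    (rootOfTwo v≡p _) = contradiction v≡p v≢p
  outcome-without-und _   v≢b _    (isolated v≡b _)  = contradiction v≡b v≢b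

  leaf-degree≡1 : ∀ {N : Net n} {v} → IsBinary N → v ∈ nodes N → IsLeaf N v → ¬ deg N v ≡ 0 → deg N v ≡ 1
  leaf-degree≡1 binN v∈ leaf deg≢0 with proj₁ (proj₂ (binN _ v∈)) leaf
  ... | inj₁ deg≡0 = contradiction deg≡0 deg≢0
  ... | inj₂ deg≡1 = deg≡1

  detach-child : ∀ {N N₀ M₁ : Net n} {p c b} → IsCompleteBinaryLNetwork N
    → Removes (edges N) (dir p c) (edges N₀) → WellFormed N₀ → c ≢ p → b ≢ c
    → IsLeaf N b → dir p b ∈ edges N → dir p b ∈ edges N₀
    → SuppressIfSuppressible p N₀ M₁ → ParentSuppression (NewLeafEdge N) N₀ M₁ p b
  detach-child {N} {N₀} {p = p} {c} {b} ((wf , _ , treeN , _) , binN , _) removes wf₀ c≢p b≢c leaf p→b p→b₀ =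
    suppress-parent wf₀ p→b₀ b≢p (subst LeafDegrees (sym b-degrees) leaf)
      (subst (λ t → proj₁ t ≤ 1) (sym b-degrees) (treeN b (proj₂ (proj₂ wf _ p→b)) leaf))
      (binary-without-child {t′ = degrees (edges N₀) p} (binN p (proj₁ (proj₂ wf _ p→b))) (removes-tail removes c≢p))
      (λ _ → newLeafEdge p→b leaf)
    where
    b≢p : b ≢ p
    b≢p refl = leaf-¬out {N = N} leaf p→b
    b-degrees : degrees (edges N₀) b ≡ degrees (edges N) b
    b-degrees = removes-¬endpoint removes (¬endpoint-dir b≢p b≢c)

  tree-cherry : ∀ {N M : Net n} {a b p} → IsCompleteBinaryLNetwork N
    → a ∈ nodes N → IsLeaf N a → ¬ deg N a ≡ 0 → IsLeaf N b → a ≢ b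
    → dir p a ∈ edges N → dir p b ∈ edges N → SuppressIfSuppressible p (deleteNode a N) M
    → IsCompleteBinaryLNetwork M
  tree-cherry {N} {M} {a} {b} {p} cN@((wf , _) , binN , _) a∈ leaf-a deg-a≢0 leaf-b a≢b p→a p→b suppression =
    reduction-complete shrinks cN compatible
    where
    N₀ : Net n
    N₀ = deleteNode a N
    a≢p : a ≢ p
    a≢p refl = leaf-¬out {N = N} leaf-a p→a
    removes : Removes (edges N) (dir p a) (edges N₀)
    removes = deleteNode-removes {N = N}
      (degree1-star {N = N} (leaf-degree≡1 {N = N} binN a∈ leaf-a deg-a≢0) p→a (inj₂ refl))
    parent : ParentSuppression (NewLeafEdge N) N₀ M p b
    parent = detach-child cN removes (deleteNode-wellFormed {N = N} wf) a≢p (a≢b ∘ sym) leaf-b p→b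
      (∈-deleteNode-edges⁺ {N = N} p→b (¬endpoint-dir a≢p a≢b)) suppression
    module parent = ParentSuppression parent
    shrinks : Shrinks (NewLeafEdge N) N M
    shrinks = shrinks-trans (deleteNode-shrinks {N = N} wf) parent.shrinks
    compatible : ∀ {v} → v ∈ nodes M → CompatibleAt N M v
    compatible {v} v∈ = outcome-compatible {N₀ = N₀} binN (Shrinks.nodes⊆ shrinks v∈) v∈
      (λ leaf → leaf-¬out {N = N} leaf p→b) leaf-b
      (λ v≢p → removes-¬endpoint removes (¬endpoint-dir v≢p v≢a)) refl (parent.outcome v)
      where
      v≢a : v ≢ a
      v≢a = proj₂ (∈-deleteNode⁻ {N = N} (Shrinks.nodes⊆ parent.shrinks v∈))

  reticulate-cherry : ∀ {N M₁ : Net n} {a b pa pb} → IsCompleteBinaryLNetwork N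
    → IsLeaf N a → IsLeaf N b → dir pa a ∈ edges N → dir pb b ∈ edges N → IsHybrid N pa
    → (pb→pa : dir pb pa ∈ edges N) → SuppressIfSuppressible pb (removeEdge N pb→pa) M₁
    → IsCompleteBinaryLNetwork (suppress pa M₁)
  reticulate-cherry {N} {M₁} {a} {b} {pa} {pb} cN@((wf , sdag , _) , binN , _)
                    leaf-a leaf-b pa→a pb→b hybrid pb→pa suppression =
    reduction-complete shrinks cN compatible
    where
    N₀ : Net n
    N₀ = removeEdge N pb→pa
    pa≢pb : pa ≢ pb
    pa≢pb refl = sdag (loop⇒cycle {N = N} pb→pa)
    a≢pa : a ≢ pa
    a≢pa refl = leaf-¬out {N = N} leaf-a pa→a
    a≢pb : a ≢ pb
    a≢pb refl = leaf-¬out {N = N} leaf-a pb→b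
    b≢pa : b ≢ pa
    b≢pa refl = leaf-¬out {N = N} leaf-b pa→a
    removes : Removes (edges N) (dir pb pa) (edges N₀)
    removes = removeEdge-removes N pb→pa
    parent : ParentSuppression (NewLeafEdge N) N₀ M₁ pb b
    parent = detach-child cN removes (removeEdge-wellFormed N pb→pa wf) pa≢pb b≢pa leaf-b pb→b
      (∈-─⁺ (edges N) pb→pa pb→b (b≢pa ∘ cong end₂)) suppression
    module parent = ParentSuppression parent
    pa-degrees : degrees (edges N) pa ≡ (2 , 1 , 0)
    pa-degrees = hybrid-degrees (binN pa (proj₁ (proj₂ wf _ pa→a))) hybrid
      (subst (_≤ degOut N pa) (b2n-refl pa) (∈⇒≤count (outC pa) pa→a))
    pa-degrees₁ : degrees (edges M₁) pa ≡ (1 , 1 , 0)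
    pa-degrees₁ = outcome-without-und pa≢pb (b≢pa ∘ sym)
      (incIn-injective (trans (sym (removes-head removes pa≢pb)) pa-degrees)) (parent.outcome pa)
    pa→a₁ : dir pa a ∈ edges M₁
    pa→a₁ = parent.edges⁺ (∈-─⁺ (edges N) pb→pa pa→a (a≢pa ∘ cong end₂))
                          (¬endpoint-dir (pa≢pb ∘ sym) (a≢pb ∘ sym))
    through-pa : Σ ℕ λ u → Σ (Through M₁ pa u a) λ through → Through.inEdge through ≡ dir u pa
    through-pa = in-out-through {N = M₁} pa-degrees₁ pa→a₁ a≢pa
    through : Through M₁ pa (proj₁ through-pa) a
    through = proj₁ (proj₂ through-pa)
    suppress-pa : Shrinks (NewLeafEdge N) M₁ (suppress pa M₁)
    suppress-pa = through-shrinks through (Shrinks.wellFormed parent.shrinks) (newLeafEdge pa→a leaf-a)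
    shrinks : Shrinks (NewLeafEdge N) N (suppress pa M₁)
    shrinks = shrinks-trans (removeEdge-shrinks pb→pa wf) (shrinks-trans parent.shrinks suppress-pa)
    compatible : ∀ {v} → v ∈ nodes (suppress pa M₁) → CompatibleAt N (suppress pa M₁) v
    compatible {v} v∈ =
      outcome-compatible {N₀ = N₀} binN (Shrinks.nodes⊆ shrinks v∈) (Shrinks.nodes⊆ suppress-pa v∈)
      (λ leaf → leaf-¬out {N = N} leaf pb→b) leaf-b
      (λ v≢pb → removes-¬endpoint removes (¬endpoint-dir v≢pb v≢pa))
      (through-same through v≢pa (inj₂ (proj₂ (proj₂ through-pa)))) (parent.outcome v)
      where
      v≢pa : v ≢ pa
      v≢pa = proj₂ (∈-deleteNode⁻ {N = M₁} v∈)

lemma2 : ∀ {n : ℕ} (N M : Net n) (a b : ℕ)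
    → IsCompleteBinaryLNetwork N
    → IsCherry N a b
    → Reduced N a b M
    → IsCompleteBinaryLNetwork M
lemma2 N M a b cN (a∈ , _ , a≢b , leaf-a , leaf-b , deg-a≢0 , _) (treeCherry p→a p→b suppression) =
  tree-cherry cN a∈ leaf-a deg-a≢0 leaf-b a≢b p→a p→b suppression
lemma2 N _ a b cN (_ , _ , _ , leaf-a , leaf-b , _) (reticulateCherry pa→a pb→b hybrid pb→pa suppression) =
  reticulate-cherry cN leaf-a leaf-b pa→a pb→b hybrid pb→pa suppression
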